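{- Let $E=\{\mathsf{trap}(\mathsf{triv}),\mathsf{trap}(\mathsf{notYet}),\mathsf{trap}(\mathsf{request}),\mathsf{trap}(\mathsf{done})\}$. Then the detailed STD $\mathsf{Client}$, with each transition label $a$ identified with the action $\mathsf{ok}(a)$, is branching bisimilar to $\tau_E\big(\widehat{\mathsf{Client}}(\mathsf{DG})\big)$.
   Context: An STD is a triple $\langle \mathsf{ST},\mathsf{AC},\mathsf{TR}\rangle$ with $\mathsf{TR}\subseteq\mathsf{ST}\times\mathsf{AC}\times\mathsf{ST}$ and a designated initial state. The detailed STD $\mathsf{Client}$ has states $\mathsf{Out},\mathsf{Waiting},\mathsf{Busy},\mathsf{AtDoor}$, initial state $\mathsf{Out}$, and transitions $\mathsf{Out}\xrightarrow{\mathsf{enter}}\mathsf{Waiting}\xrightarrow{\mathsf{explain}}\mathsf{Busy}\xrightarrow{\mathsf{thank}}\mathsf{AtDoor}\xrightarrow{\mathsf{leave}}\mathsf{Out}$. Let $\mathsf{Labels}_D=\{\mathsf{enter},\mathsf{explain},\mathsf{thank},\mathsf{leave}\}$, $\mathsf{States}_D=\{\mathsf{Out},\mathsf{Waiting},\mathsf{Busy},\mathsf{AtDoor}\}$. Process algebra (ACP with $\tau$): $\cdot$ sequential composition, $+$ choice, $\parallel$ parallel composition with communication function $|$, $\partial_J$ encapsulation (blocking actions in $J$), $\tau_I$ hiding (renaming actions in $I$ to $\tau$). Specification $\widehat{\mathsf{Client}}$ (initial $\mathsf{Out}$): $\mathsf{Out}=\mathsf{at}!(\mathsf{Out})\cdot\mathsf{Out}+\mathsf{ok}?(\mathsf{enter})\cdot\mathsf{Waiting}$;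 $\mathsf{Waiting}=\mathsf{at}!(\mathsf{Waiting})\cdot\mathsf{Waiting}+\mathsf{ok}?(\mathsf{explain})\cdot\mathsf{Busy}$; $\mathsf{Busy}=\mathsf{ok}?(\mathsf{thank})\cdot\mathsf{AtDoor}$; $\mathsf{AtDoor}=\mathsf{at}!(\mathsf{AtDoor})\cdot\mathsf{AtDoor}+\mathsf{ok}?(\mathsf{leave})\cdot\mathsf{Out}$. Specification $\widehat{\mathsf{Client}}(\mathsf{CS})$ (initial $\mathsf{Without}[\mathsf{triv}]$): $\mathsf{Without}[\mathsf{triv}]=\mathsf{ok}!(\mathsf{leave})\cdot\mathsf{Without}[\mathsf{triv}]+\mathsf{ok}!(\mathsf{enter})\cdot\mathsf{Without}[\mathsf{triv}]+\mathsf{trap}(\mathsf{triv})\cdot\mathsf{Interrupt}[\mathsf{triv}]$; $\mathsf{Interrupt}[\mathsf{triv}]=\mathsf{at}?(\mathsf{AtDoor})\cdot\mathsf{Interrupt}[\mathsf{notYet}]+\mathsf{at}?(\mathsf{Out})\cdot\mathsf{Interrupt}[\mathsf{notYet}]+\mathsf{at}?(\mathsf{Waiting})\cdot\mathsf{Interrupt}[\mathsf{request}]+\mathsf{ok}!(\mathsf{leave})\cdot\mathsf{Interrupt}[\mathsf{triv}]$; $\mathsf{Interrupt}[\mathsf{notYet}]=\mathsf{ok}!(\mathsf{leave})\cdot\mathsf{Interrupt}[\mathsf{notYet}]+\mathsf{trap}(\mathsf{notYet})\cdot\mathsf{Without}[\mathsf{triv}]$; $\mathsf{Interrupt}[\mathsf{request}]=\mathsf{trap}(\mathsf{request})\cdot\mathsf{With}[\mathsf{triv}]$;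 $\mathsf{With}[\mathsf{triv}]=\mathsf{at}?(\mathsf{AtDoor})\cdot\mathsf{With}[\mathsf{done}]+\mathsf{ok}!(\mathsf{explain})\cdot\mathsf{With}[\mathsf{triv}]+\mathsf{ok}!(\mathsf{thank})\cdot\mathsf{With}[\mathsf{triv}]$; $\mathsf{With}[\mathsf{done}]=\mathsf{trap}(\mathsf{done})\cdot\mathsf{Without}[\mathsf{triv}]$. Communication: $\mathsf{at}!(s)\,|\,\mathsf{at}?(s)=\tau$ for $s\in\{\mathsf{Out},\mathsf{Waiting},\mathsf{AtDoor}\}$, $\mathsf{ok}?(a)\,|\,\mathsf{ok}!(a)=\mathsf{ok}(a)$ for $a\in\mathsf{Labels}_D$; no other communications. $H=\{\mathsf{at}!(s),\mathsf{at}?(s)\mid s\in\mathsf{States}_D\}\cup\{\mathsf{ok}!(a),\mathsf{ok}?(a)\mid a\in\mathsf{Labels}_D\}$ and $\widehat{\mathsf{Client}}(\mathsf{DG})=\partial_H(\widehat{\mathsf{Client}}\parallel\widehat{\mathsf{Client}}(\mathsf{CS}))$. Branching bisimulation: a symmetric relation $R$ between states of two STDs such that if $R(s,t)$ and $s\xrightarrow{a}s'$, then either $a=\tau$ and $R(s',t)$, or there are $t\xrightarrow{\tau}t_1\cdots\xrightarrow{\tau}t_n\xrightarrow{a}t'$ ($n\ge0$) with $R(s,t_j)$ for all $j$ and $R(s',t')$. Two STDs are branching bisimilar if their initial states are related by some branching bisimulation. -}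

module Defs where

open import Level using (0ℓ)
open import Data.Product using (Σ; ∃; _×_; _,_)
open import Data.Sum using (_⊎_)
open import Data.Nat using (ℕ)
open import Relation.Nullary using (¬_)
open import Relation.Binary.PropositionalEquality using (_≡_)

data StateD : Set where
  Out Waiting Busy AtDoor : StateD

data Label : Set where
  enter explain thank leave : Label

data TrapL : Set where
  triv notYet request done : TrapL

data Act : Set where
  at!  : StateD → Act
  at?  : StateD → Act
  ok!  : Label → Act
  ok?  : Label → Act
  ok   : Label → Act
  trap : TrapL → Act
  τ    : Act

record STD : Set₁ where
  field
    ST   : Set
    TR   : ST → Act → ST → Set
    init : ST
open STD public

data ClientTR : StateD → Act → StateD → Set where
  t-enter   : ClientTR Out     (ok enter)   Waiting
  t-explain : ClientTR Waiting (ok explain) Busy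
  t-thank   : ClientTR Busy    (ok thank)   AtDoor
  t-leave   : ClientTR AtDoor  (ok leave)   Out

Client : STD
Client = record { ST = StateD ; TR = ClientTR ; init = Out }

data CommState : StateD → Set where
  c-Out     : CommState Out
  c-Waiting : CommState Waiting
  c-AtDoor  : CommState AtDoor

data Comm : Act → Act → Act → Set where
  comm-at  : ∀ {s} → CommState s → Comm (at! s) (at? s) τ
  comm-at' : ∀ {s} → CommState s → Comm (at? s) (at! s) τ
  comm-ok  : ∀ {a} → Comm (ok? a) (ok! a) (ok a)
  comm-ok' : ∀ {a} → Comm (ok! a) (ok? a) (ok a)

data ParTR (P Q : STD) : ST P × ST Q → Act → ST P × ST Q → Set where
  left  : ∀ {p p' q a} → TR P p a p' → ParTR P Q (p , q) a (p' , q)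
  right : ∀ {p q q' a} → TR Q q a q' → ParTR P Q (p , q) a (p , q')
  sync  : ∀ {p p' q q' a b c} → TR P p a p' → TR Q q b q' → Comm a b c →
          ParTR P Q (p , q) c (p' , q')

_∥_ : STD → STD → STD
P ∥ Q = record { ST = ST P × ST Q ; TR = ParTR P Q ; init = (init P , init Q) }

∂ : (Act → Set) → STD → STD
∂ J P = record { ST = ST P
               ; TR = λ s a s' → TR P s a s' × ¬ J a
               ; init = init P }

HideTR : (Act → Set) → (P : STD) → ST P → Act → ST P → Set
HideTR I P s b s' = ∃ λ a → TR P s a s' × ((I a × b ≡ τ) ⊎ (¬ I a × b ≡ a))

hide : (Act → Set) → STD → STD
hide I P = record { ST = ST P ; TR = HideTR I P ; init = init P }

data ClientHatTR : StateD → Act → StateD → Set where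
  h-out-at  : ClientHatTR Out     (at! Out)     Out
  h-out-ok  : ClientHatTR Out     (ok? enter)   Waiting
  h-wai-at  : ClientHatTR Waiting (at! Waiting) Waiting
  h-wai-ok  : ClientHatTR Waiting (ok? explain) Busy
  h-bus-ok  : ClientHatTR Busy    (ok? thank)   AtDoor
  h-atd-at  : ClientHatTR AtDoor  (at! AtDoor)  AtDoor
  h-atd-ok  : ClientHatTR AtDoor  (ok? leave)   Out

ClientHat : STD
ClientHat = record { ST = StateD ; TR = ClientHatTR ; init = Out }

data CSState : Set where
  Without-triv      : CSState
  Interrupt-triv    : CSState
  Interrupt-notYet  : CSState
  Interrupt-request : CSState
  With-triv         : CSState
  With-done         : CSState

data CSTR : CSState → Act → CSState → Set where
  w1 : CSTR Without-triv (ok! leave) Without-triv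
  w2 : CSTR Without-triv (ok! enter) Without-triv
  w3 : CSTR Without-triv (trap triv) Interrupt-triv
  i1 : CSTR Interrupt-triv (at? AtDoor)  Interrupt-notYet
  i2 : CSTR Interrupt-triv (at? Out)     Interrupt-notYet
  i3 : CSTR Interrupt-triv (at? Waiting) Interrupt-request
  i4 : CSTR Interrupt-triv (ok! leave)   Interrupt-triv
  n1 : CSTR Interrupt-notYet (ok! leave)    Interrupt-notYet
  n2 : CSTR Interrupt-notYet (trap notYet)  Without-triv
  r1 : CSTR Interrupt-request (trap request) With-triv
  v1 : CSTR With-triv (at? AtDoor)  With-done
  v2 : CSTR With-triv (ok! explain) With-triv
  v3 : CSTR With-triv (ok! thank)   With-triv
  d1 : CSTR With-done (trap done) Without-triv

ClientCS : STD
ClientCS = record { ST = CSState ; TR = CSTR ; init = Without-triv }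

data H : Act → Set where
  H-at! : ∀ s → H (at! s)
  H-at? : ∀ s → H (at? s)
  H-ok! : ∀ a → H (ok! a)
  H-ok? : ∀ a → H (ok? a)

data E : Act → Set where
  E-triv    : E (trap triv)
  E-notYet  : E (trap notYet)
  E-request : E (trap request)
  E-done    : E (trap done)

ClientDG : STD
ClientDG = ∂ H (ClientHat ∥ ClientCS)

data TauPath (P Q : STD) (R : ST P → ST Q → Set) (s : ST P) :
             ST Q → ST Q → Set where
  here : ∀ {t} → TauPath P Q R s t t
  step : ∀ {t t₁ tₙ} → TR Q t τ t₁ → R s t₁ → TauPath P Q R s t₁ tₙ →
         TauPath P Q R s t tₙ

Transfer : (P Q : STD) → (ST P → ST Q → Set) → Set
Transfer P Q R =
  ∀ {s t s' a} → R s t → TR P s a s' →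
    (a ≡ τ × R s' t)
    ⊎ (∃ λ tₙ → ∃ λ t' → TauPath P Q R s t tₙ × TR Q tₙ a t' × R s' t')

record IsBranchingBisim (P Q : STD) (R : ST P → ST Q → Set) : Set where
  field
    forth : Transfer P Q R
    back  : Transfer Q P (λ t s → R s t)

BranchingBisimilar : STD → STD → Set₁
BranchingBisimilar P Q =
  Σ (ST P → ST Q → Set) λ R → IsBranchingBisim P Q R × R (init P) (init Q)

-- Relate a state s of Client to the reachable states of τ_E(Client^(DG)) whose Client^
-- component is s.  From each of them silent moves (hidden traps and at-handshakes) lead to
-- the state where CS offers ok!(a) for the unique move a of s, and every visible move
-- available along the way is ok(a) itself.  So the composite matches each move of Client
-- after a silent prefix, and Client matches each visible move of the composite directly.
module Submission where

open import Defs
open import Data.Product using (∃; _×_; _,_)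
open import Data.Sum using (_⊎_; inj₁; inj₂; [_,_])
open import Data.Empty using (⊥-elim)
open import Relation.Nullary using (¬_)
open import Relation.Binary.PropositionalEquality using (_≡_; refl)

hide-hidden : ∀ {I} P {s a s'} → TR P s a s' → I a → TR (hide I P) s τ s'
hide-hidden _ st i = _ , st , inj₁ (i , refl)

hide-visible : ∀ {I} P {s a s'} → TR P s a s' → ¬ I a → TR (hide I P) s a s'
hide-visible _ st ¬i = _ , st , inj₂ (¬i , refl)

ClientHat-act∈H : ∀ {p a p'} → ClientHatTR p a p' → H a
ClientHat-act∈H h-out-at = H-at! _
ClientHat-act∈H h-out-ok = H-ok? _
ClientHat-act∈H h-wai-at = H-at! _
ClientHat-act∈H h-wai-ok = H-ok? _
ClientHat-act∈H h-bus-ok = H-ok? _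
ClientHat-act∈H h-atd-at = H-at! _
ClientHat-act∈H h-atd-ok = H-ok? _

ClientCS-act∈H⊎E : ∀ {c a c'} → CSTR c a c' → H a ⊎ E a
ClientCS-act∈H⊎E w1 = inj₁ (H-ok! _)
ClientCS-act∈H⊎E w2 = inj₁ (H-ok! _)
ClientCS-act∈H⊎E w3 = inj₂ E-triv
ClientCS-act∈H⊎E i1 = inj₁ (H-at? _)
ClientCS-act∈H⊎E i2 = inj₁ (H-at? _)
ClientCS-act∈H⊎E i3 = inj₁ (H-at? _)
ClientCS-act∈H⊎E i4 = inj₁ (H-ok! _)
ClientCS-act∈H⊎E n1 = inj₁ (H-ok! _)
ClientCS-act∈H⊎E n2 = inj₂ E-notYet
ClientCS-act∈H⊎E r1 = inj₂ E-request
ClientCS-act∈H⊎E v1 = inj₁ (H-at? _)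
ClientCS-act∈H⊎E v2 = inj₁ (H-ok! _)
ClientCS-act∈H⊎E v3 = inj₁ (H-ok! _)
ClientCS-act∈H⊎E d1 = inj₂ E-done

trap∈E : ∀ l → E (trap l)
trap∈E triv    = E-triv
trap∈E notYet  = E-notYet
trap∈E request = E-request
trap∈E done    = E-done

HiddenDG : STD
HiddenDG = hide E ClientDG

-- Every Client^ action is encapsulated, so the composite moves only by a CS trap or by a
-- synchronisation in which Client^ sends at!(s) or receives ok?(a).
data HiddenDGStep : StateD × CSState → Act → StateD × CSState → Set where
  trap-step : ∀ {d c l c'} → CSTR c (trap l) c' → HiddenDGStep (d , c) τ (d , c')
  at-step   : ∀ {d d' c c' s} → CommState s → ClientHatTR d (at! s) d' → CSTR c (at? s) c' →
              HiddenDGStep (d , c) τ (d' , c')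
  ok-step   : ∀ {d d' c c' a} → ClientHatTR d (ok? a) d' → CSTR c (ok! a) c' →
              HiddenDGStep (d , c) (ok a) (d' , c')

HiddenDGStep⇒TR : ∀ {t b t'} → HiddenDGStep t b t' → TR HiddenDG t b t'
HiddenDGStep⇒TR (trap-step y)    = hide-hidden ClientDG (right y , λ ()) (trap∈E _)
HiddenDGStep⇒TR (at-step cs x y) = hide-visible ClientDG (sync x y (comm-at cs) , λ ()) λ ()
HiddenDGStep⇒TR (ok-step x y)    = hide-visible ClientDG (sync x y comm-ok , λ ()) λ ()

TR⇒HiddenDGStep : ∀ {t b t'} → TR HiddenDG t b t' → HiddenDGStep t b t'
TR⇒HiddenDGStep (_ , (left x , ∉H) , _)                      = ⊥-elim (∉H (ClientHat-act∈H x))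
TR⇒HiddenDGStep (_ , (right y , _) , inj₁ (E-triv , refl))    = trap-step y
TR⇒HiddenDGStep (_ , (right y , _) , inj₁ (E-notYet , refl))  = trap-step y
TR⇒HiddenDGStep (_ , (right y , _) , inj₁ (E-request , refl)) = trap-step y
TR⇒HiddenDGStep (_ , (right y , _) , inj₁ (E-done , refl))    = trap-step y
TR⇒HiddenDGStep (_ , (right y , ∉H) , inj₂ (∉E , _)) = ⊥-elim ([ ∉H , ∉E ] (ClientCS-act∈H⊎E y))
TR⇒HiddenDGStep (_ , (sync x y (comm-at cs) , _) , inj₁ (() , _))
TR⇒HiddenDGStep (_ , (sync x y (comm-at cs) , _) , inj₂ (_ , refl)) = at-step cs x y
TR⇒HiddenDGStep (_ , (sync () y (comm-at' cs) , _) , _)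
TR⇒HiddenDGStep (_ , (sync x y comm-ok , _) , inj₁ (() , _))
TR⇒HiddenDGStep (_ , (sync x y comm-ok , _) , inj₂ (_ , refl)) = ok-step x y
TR⇒HiddenDGStep (_ , (sync () y comm-ok' , _) , _)

data Related : StateD → StateD × CSState → Set where
  out-without       : Related Out     (Out     , Without-triv)
  out-interrupt     : Related Out     (Out     , Interrupt-triv)
  out-notYet        : Related Out     (Out     , Interrupt-notYet)
  waiting-without   : Related Waiting (Waiting , Without-triv)
  waiting-interrupt : Related Waiting (Waiting , Interrupt-triv)
  waiting-request   : Related Waiting (Waiting , Interrupt-request)
  waiting-with      : Related Waiting (Waiting , With-triv)
  busy-with         : Related Busy    (Busy    , With-triv)
  atDoor-with       : Related AtDoor  (AtDoor  , With-triv)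
  atDoor-done       : Related AtDoor  (AtDoor  , With-done)
  atDoor-without    : Related AtDoor  (AtDoor  , Without-triv)
  atDoor-interrupt  : Related AtDoor  (AtDoor  , Interrupt-triv)
  atDoor-notYet     : Related AtDoor  (AtDoor  , Interrupt-notYet)

ready : StateD → CSState
ready Out     = Without-triv
ready Waiting = With-triv
ready Busy    = With-triv
ready AtDoor  = Without-triv

SilentPath : StateD → StateD × CSState → StateD × CSState → Set
SilentPath = TauPath Client HiddenDG Related

_⟶_∷_ : ∀ {s t t₁ tₙ} → HiddenDGStep t τ t₁ → Related s t₁ → SilentPath s t₁ tₙ → SilentPath s t tₙ
st ⟶ r ∷ path = step (HiddenDGStep⇒TR st) r path
infixr 5 _⟶_∷_

reach-ready : ∀ {s t} → Related s t → SilentPath s t (s , ready s)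
reach-ready out-without       = here
reach-ready out-interrupt     = at-step c-Out h-out-at i2 ⟶ out-notYet ∷
                                trap-step n2 ⟶ out-without ∷ here
reach-ready out-notYet        = trap-step n2 ⟶ out-without ∷ here
reach-ready waiting-without   = trap-step w3 ⟶ waiting-interrupt ∷
                                at-step c-Waiting h-wai-at i3 ⟶ waiting-request ∷
                                trap-step r1 ⟶ waiting-with ∷ here
reach-ready waiting-interrupt = at-step c-Waiting h-wai-at i3 ⟶ waiting-request ∷
                                trap-step r1 ⟶ waiting-with ∷ here
reach-ready waiting-request   = trap-step r1 ⟶ waiting-with ∷ here
reach-ready waiting-with      = here
reach-ready busy-with         = here
reach-ready atDoor-with       = at-step c-AtDoor h-atd-at v1 ⟶ atDoor-done ∷
                                trap-step d1 ⟶ atDoor-without ∷ here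
reach-ready atDoor-done       = trap-step d1 ⟶ atDoor-without ∷ here
reach-ready atDoor-without    = here
reach-ready atDoor-interrupt  = at-step c-AtDoor h-atd-at i1 ⟶ atDoor-notYet ∷
                                trap-step n2 ⟶ atDoor-without ∷ here
reach-ready atDoor-notYet     = trap-step n2 ⟶ atDoor-without ∷ here

ready-move : ∀ {s a s'} → ClientTR s a s' → ∃ λ t' → TR HiddenDG (s , ready s) a t' × Related s' t'
ready-move t-enter   = _ , HiddenDGStep⇒TR (ok-step h-out-ok w2) , waiting-without
ready-move t-explain = _ , HiddenDGStep⇒TR (ok-step h-wai-ok v2) , busy-with
ready-move t-thank   = _ , HiddenDGStep⇒TR (ok-step h-bus-ok v3) , atDoor-with
ready-move t-leave   = _ , HiddenDGStep⇒TR (ok-step h-atd-ok w1) , out-without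

related-step : ∀ {s t b t'} → Related s t → HiddenDGStep t b t' →
               (b ≡ τ × Related s t') ⊎ (∃ λ s' → ClientTR s b s' × Related s' t')
related-step out-without       (trap-step w3)             = inj₁ (refl , out-interrupt)
related-step out-without       (ok-step h-out-ok w2)      = inj₂ (_ , t-enter , waiting-without)
related-step out-interrupt     (at-step _ h-out-at i2)    = inj₁ (refl , out-notYet)
related-step out-notYet        (trap-step n2)             = inj₁ (refl , out-without)
related-step waiting-without   (trap-step w3)             = inj₁ (refl , waiting-interrupt)
related-step waiting-interrupt (at-step _ h-wai-at i3)    = inj₁ (refl , waiting-request)
related-step waiting-request   (trap-step r1)             = inj₁ (refl , waiting-with)
related-step waiting-with      (ok-step h-wai-ok v2)      = inj₂ (_ , t-explain , busy-with)
related-step busy-with         (ok-step h-bus-ok v3)      = inj₂ (_ , t-thank , atDoor-with)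
related-step atDoor-with       (at-step _ h-atd-at v1)    = inj₁ (refl , atDoor-done)
related-step atDoor-done       (trap-step d1)             = inj₁ (refl , atDoor-without)
related-step atDoor-without    (trap-step w3)             = inj₁ (refl , atDoor-interrupt)
related-step atDoor-without    (ok-step h-atd-ok w1)      = inj₂ (_ , t-leave , out-without)
related-step atDoor-interrupt  (at-step _ h-atd-at i1)    = inj₁ (refl , atDoor-notYet)
related-step atDoor-interrupt  (ok-step h-atd-ok i4)      = inj₂ (_ , t-leave , out-interrupt)
related-step atDoor-notYet     (trap-step n2)             = inj₁ (refl , atDoor-without)
related-step atDoor-notYet     (ok-step h-atd-ok n1)      = inj₂ (_ , t-leave , out-notYet)
related-step out-interrupt     (ok-step h-out-ok ())
related-step out-notYet        (ok-step h-out-ok ())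
related-step waiting-without   (ok-step h-wai-ok ())
related-step waiting-interrupt (ok-step h-wai-ok ())
related-step waiting-with      (trap-step ())
related-step waiting-with      (at-step _ h-wai-at ())
related-step atDoor-with       (ok-step h-atd-ok ())

lemma2 : BranchingBisimilar Client (hide E ClientDG)
lemma2 = Related , record { forth = forth ; back = back } , out-without
  where
  forth : Transfer Client HiddenDG Related
  forth r tr with ready-move tr
  ... | t' , move , r' = inj₂ (_ , t' , reach-ready r , move , r')

  back : Transfer HiddenDG Client (λ t s → Related s t)
  back r st with related-step r (TR⇒HiddenDGStep st)
  ... | inj₁ silent          = inj₁ silent
  ... | inj₂ (s' , tr , r') = inj₂ (_ , s' , here , tr , r')
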